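{- Let $T$ be a binary tree. The linear extensions of its final forest $F_{\ge}(T)$ are exactly the permutations belonging to the sylvester classes of the binary trees $T'\ge T$ in the Tamari order. Likewise, the linear extensions of its initial forest $F_{\le}(T)$ are exactly the permutations belonging to the sylvester classes of the trees $T'\le T$.
   Context: A binary tree is empty or a root with an ordered pair (left, right) of binary subtrees; size = number of nodes. Each binary tree of size $n$ is identified with its unique labelling by $1,\dots,n$ as a binary search tree (every label in the left subtree of a node is smaller than the node's label, every label in the right subtree larger). For labels $a,b$ write $a\triangleleft_T b$ if $a$ lies in the subtree rooted at $b$. Tamari order: $T\le T'$ iff $T'$ is obtained from $T$ by a sequence of right rotations $y(x(A,B),C)\to x(A,y(B,C))$. For a permutation $\sigma=\sigma_1\cdots\sigma_n$, $\mathrm{ABR}(\sigma)$ is the binary search tree obtained by inserting $\sigma_n,\sigma_{n-1},\dots,\sigma_1$ successively into an initially empty tree (inserting $k$: into an empty tree, $k$ becomes the root; otherwise insert into the left subtree if $k\le$ root label, else into the right subtree). The sylvester class of $T$ is the set of $\sigma$ with $\mathrm{ABR}(\sigma)$ of shape $T$. The final forest $F_{\ge}(T)$ is the poset on $\{1,\dots,n\}$ with $b\triangleleft a$ iff $a<b$ and $b\triangleleft_T a$; the initial forest $F_{\le}(T)$ is the poset with $a\triangleleft c$ iff $a<c$ and $a\triangleleft_T c$. A linear extension of a poset on $\{1,\dots,n\}$ is a permutation (word) in which $u$ appears before $v$ whenever $u\triangleleft v$. -}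

module Defs where

open import Data.Nat using (ℕ; zero; suc; _+_; _<_; _≤_)
open import Data.Nat.Properties using (_≤?_)
open import Data.List using (List; []; _∷_; _++_; map; foldr; upTo)
open import Data.List.Relation.Binary.Permutation.Propositional using (_↭_)
open import Data.Product using (Σ; ∃; _×_; _,_)
open import Relation.Nullary using (yes; no)
open import Relation.Binary.PropositionalEquality using (_≡_)
open import Relation.Binary.Construct.Closure.ReflexiveTransitive using (Star)

data Tree : Set where
  leaf : Tree
  node : Tree → Tree → Tree

size : Tree → ℕ
size leaf = 0
size (node l r) = suc (size l + size r)

-- Desc o t a b : with t labelled as a binary search tree by o+1,…,o+size t,
-- the label a lies in the subtree rooted at the node labelled b (a = b allowed).
data Desc : ℕ → Tree → ℕ → ℕ → Set where
  here  : ∀ {o l r a} → o < a → a ≤ o + size (node l r) →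
          Desc o (node l r) a (suc (o + size l))
  left  : ∀ {o l r a b} → Desc o l a b → Desc o (node l r) a b
  right : ∀ {o l r a b} → Desc (suc (o + size l)) r a b → Desc o (node l r) a b

_◁[_]_ : ℕ → Tree → ℕ → Set
a ◁[ T ] b = Desc 0 T a b

data RightRot : Tree → Tree → Set where
  rot : ∀ {A B C} → RightRot (node (node A B) C) (node A (node B C))
  inL : ∀ {l l' r} → RightRot l l' → RightRot (node l r) (node l' r)
  inR : ∀ {l r r'} → RightRot r r' → RightRot (node l r) (node l r')

_≤T_ : Tree → Tree → Set
T ≤T T' = Star RightRot T T'

data BST : Set where
  lf : BST
  nd : BST → ℕ → BST → BST

insert : ℕ → BST → BST
insert k lf = nd lf k lf
insert k (nd l x r) with k ≤? x
... | yes _ = nd (insert k l) x r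
... | no  _ = nd l x (insert k r)

-- inserts σ_n, σ_{n-1}, …, σ_1 successively
ABR : List ℕ → BST
ABR σ = foldr insert lf σ

shape : BST → Tree
shape lf = leaf
shape (nd l _ r) = node (shape l) (shape r)

IsPerm : ℕ → List ℕ → Set
IsPerm n σ = σ ↭ map suc (upTo n)

InSylv : Tree → List ℕ → Set
InSylv T σ = IsPerm (size T) σ × shape (ABR σ) ≡ T

Before : List ℕ → ℕ → ℕ → Set
Before σ u v = Σ (List ℕ) λ xs → Σ (List ℕ) λ ys → Σ (List ℕ) λ zs →
  σ ≡ xs ++ (u ∷ ys ++ (v ∷ zs))

LinExt : ℕ → (ℕ → ℕ → Set) → List ℕ → Set
LinExt n _◁_ σ = IsPerm n σ × (∀ u v → u ◁ v → Before σ u v)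

FinalForest : Tree → ℕ → ℕ → Set
FinalForest T b a = a < b × b ◁[ T ] a

InitialForest : Tree → ℕ → ℕ → Set
InitialForest T a c = a < c × a ◁[ T ] c

-- In ABR σ a label b lies below a ≠ b only if b occurs before a in σ, and b does lie below a
-- as soon as every label between a and b other than a occurs before a. Since the descendants
-- of a node form an interval of labels, a linear extension σ of F≥(T) therefore satisfies
-- F≥(T) ⊆ F≥(ABR σ), while every σ is a linear extension of F≥ of its own tree. Finally,
-- T ≤ T' iff F≥(T) ⊆ F≥(T') for trees of equal size: a right rotation only adds
-- relations to F≥; conversely the root label of T' is no descendant of a smaller label in T,
-- so right rotations lift it to the root of T, and one recurses into both subtrees. The
-- initial forest is symmetric, with the inclusions reversed.

module Submission where

open import Defs
open import Data.Nat using (ℕ; suc; _+_; _<_; _≤_; z≤n; s≤s)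
open import Data.Nat.Properties
open import Data.Product using (∃; _×_; _,_; proj₁; proj₂)
open import Data.Sum using (_⊎_; inj₁; inj₂; [_,_]′)
  renaming (map₁ to ⊎-map₁; map₂ to ⊎-map₂; swap to ⊎-swap)
open import Data.List using (List; []; _∷_; _++_; length; map; upTo)
open import Data.List.Properties
  using (∷-injective; ∷-injectiveˡ; ∷-injectiveʳ; length-++; length-map; length-upTo)
open import Data.List.Membership.Propositional using (_∈_; _∉_)
open import Data.List.Membership.Propositional.Properties
  using (∈-++⁺ˡ; ∈-++⁺ʳ; ∈-++⁻; ∈-∃++; ∈-map⁺; ∈-map⁻; ∈-upTo⁺; ∈-upTo⁻)
open import Data.List.Membership.Propositional.Properties.WithK using (unique∧set⇒bag)
open import Data.List.Relation.Unary.Any using (here; there)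
open import Data.List.Relation.Unary.All as All using (All; []; _∷_)
open import Data.List.Relation.Unary.AllPairs as AllPairs using (AllPairs; []; _∷_)
open import Data.List.Relation.Unary.AllPairs.Properties using (++⁺)
open import Data.List.Relation.Unary.Unique.Propositional using (Unique)
open import Data.List.Relation.Unary.Unique.Propositional.Properties
  using (Unique[x∷xs]⇒x∉xs; upTo⁺) renaming (map⁺ to Unique-map⁺)
open import Data.List.Relation.Unary.Sorted.TotalOrder using (Sorted)
open import Data.List.Relation.Unary.Sorted.TotalOrder.Properties using (AllPairs⇒Sorted; ↗↭↗⇒≋)
open import Data.List.Relation.Binary.BagAndSetEquality using (_∼[_]_; set; ∼bag⇒↭)
open import Data.List.Relation.Binary.Pointwise using (Pointwise-≡⇒≡)
open import Data.List.Relation.Binary.Permutation.Propositional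
  using (_↭_; ↭-refl; ↭-sym; ↭-trans; ↭-prep; ↭-swap; ↭⇒↭ₛ; module PermutationReasoning)
open import Data.List.Relation.Binary.Permutation.Propositional.Properties
  using (∈-resp-↭; All-resp-↭; ++⁺ˡ; ++⁺ʳ; shift; ↭-length)
open import Function.Base using (id; _∘_)
open import Function.Bundles using (_⇔_; mk⇔)
open import Relation.Nullary using (¬_; contradiction; yes; no)
open import Relation.Binary.Core using (_⇒_)
open import Relation.Binary.Definitions using (tri<; tri≈; tri>)
open import Relation.Binary.PropositionalEquality
open import Relation.Binary.Construct.Closure.ReflexiveTransitive using (ε; _◅_; _◅◅_; gmap)
open import Data.List.Relation.Binary.Permutation.Setoid.Properties (setoid ℕ) using (Unique-resp-↭)

-- Labels and descendants

Final Initial : ℕ → Tree → ℕ → ℕ → Set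
Final o T b a = a < b × Desc o T b a
Initial o T a c = a < c × Desc o T a c

rootLabel : ℕ → Tree → ℕ
rootLabel o l = suc (o + size l)

record InRange (o : ℕ) (t : Tree) (a : ℕ) : Set where
  constructor _,_
  field
    lower : o < a
    upper : a ≤ o + size t

right-offset : ∀ o l r → rootLabel o l + size r ≡ o + size (node l r)
right-offset o l r = trans (cong suc (+-assoc o (size l) (size r))) (sym (+-suc o _))

rootLabel-shift : ∀ o l r → rootLabel (rootLabel o l) r ≡ rootLabel o (node l r)
rootLabel-shift o l r = cong suc (right-offset o l r)

inRange-root : ∀ o l r → InRange o (node l r) (rootLabel o l)
inRange-root o l r =
  s≤s (m≤m+n o (size l)) , subst (rootLabel o l ≤_) (right-offset o l r) (m≤m+n _ (size r))

inRange-left : ∀ {o l r a} → InRange o l a → InRange o (node l r) a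
inRange-left {o} {l} {r} (lo , hi) = lo , ≤-trans hi (+-monoʳ-≤ o (m≤n⇒m≤1+n (m≤m+n (size l) (size r))))

inRange-right : ∀ {o l r a} → InRange (rootLabel o l) r a → InRange o (node l r) a
inRange-right {o} {l} {r} {a} (lo , hi) =
  <-trans (InRange.lower (inRange-root o l r)) lo , subst (a ≤_) (right-offset o l r) hi

<rootLabel : ∀ {o l a} → InRange o l a → a < rootLabel o l
<rootLabel (_ , hi) = s≤s hi

inRange-resize : ∀ {o t t' a} → size t ≡ size t' → InRange o t a → InRange o t' a
inRange-resize {o} {a = a} e (lo , hi) = lo , subst (λ m → a ≤ o + m) e hi

inRange-left⁻ : ∀ {o l r a} → InRange o (node l r) a → a < rootLabel o l → InRange o l a
inRange-left⁻ (lo , _) a< = lo , ≤-pred a<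

inRange-right⁻ : ∀ {o l r a} → InRange o (node l r) a → rootLabel o l < a → InRange (rootLabel o l) r a
inRange-right⁻ {o} {l} {r} {a} (_ , hi) <a = <a , subst (a ≤_) (sym (right-offset o l r)) hi

inRange-leaf : ∀ {o a} → ¬ InRange o leaf a
inRange-leaf {o} (lo , hi) = <-irrefl refl (<-≤-trans lo (subst (_ ≤_) (+-identityʳ o) hi))

desc-inRange : ∀ {o t a b} → Desc o t a b → InRange o t a
desc-inRange (here lo hi) = lo , hi
desc-inRange (left d) = inRange-left (desc-inRange d)
desc-inRange (right d) = inRange-right (desc-inRange d)

anc-inRange : ∀ {o t a b} → Desc o t a b → InRange o t b
anc-inRange {o} (here {l = l} {r} _ _) = inRange-root o l r
anc-inRange (left d) = inRange-left (anc-inRange d)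
anc-inRange (right d) = inRange-right (anc-inRange d)

root-Desc : ∀ {o l r a} → InRange o (node l r) a → Desc o (node l r) a (rootLabel o l)
root-Desc (lo , hi) = here lo hi

_∈⟦_,_⟧ : ℕ → ℕ → ℕ → Set
c ∈⟦ a , b ⟧ = (a ≤ c × c ≤ b) ⊎ (b ≤ c × c ≤ a)

∈⟦⟧-endpoint : ∀ a b → b ∈⟦ a , b ⟧
∈⟦⟧-endpoint a b with ≤-total a b
... | inj₁ a≤b = inj₁ (a≤b , ≤-refl)
... | inj₂ b≤a = inj₂ (≤-refl , b≤a)

∈⟦⟧-trans : ∀ {a b c d} → d ∈⟦ a , c ⟧ → c ∈⟦ a , b ⟧ → d ∈⟦ a , b ⟧
∈⟦⟧-trans (inj₁ (a≤d , d≤c)) (inj₁ (_ , c≤b)) = inj₁ (a≤d , ≤-trans d≤c c≤b)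
∈⟦⟧-trans (inj₁ (a≤d , d≤c)) (inj₂ (b≤c , c≤a)) = inj₂ (≤-trans b≤c (≤-trans c≤a a≤d) , ≤-trans d≤c c≤a)
∈⟦⟧-trans (inj₂ (c≤d , d≤a)) (inj₁ (a≤c , c≤b)) = inj₁ (≤-trans a≤c c≤d , ≤-trans d≤a (≤-trans a≤c c≤b))
∈⟦⟧-trans (inj₂ (c≤d , d≤a)) (inj₂ (b≤c , _)) = inj₂ (≤-trans b≤c c≤d , d≤a)

∈⟦⟧-above : ∀ {a b c} → a < b → c ∈⟦ a , b ⟧ → c ≢ a → a < c
∈⟦⟧-above _ (inj₁ (a≤c , _)) c≢a = ≤∧≢⇒< a≤c (≢-sym c≢a)
∈⟦⟧-above a<b (inj₂ (b≤c , c≤a)) _ = contradiction (<-≤-trans a<b (≤-trans b≤c c≤a)) (<-irrefl refl)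

∈⟦⟧-below : ∀ {a c x} → a < c → x ∈⟦ c , a ⟧ → x ≢ c → x < c
∈⟦⟧-below a<c (inj₁ (c≤x , x≤a)) _ = contradiction (<-≤-trans a<c (≤-trans c≤x x≤a)) (<-irrefl refl)
∈⟦⟧-below _ (inj₂ (_ , x≤c)) x≢c = ≤∧≢⇒< x≤c x≢c

inRange-between : ∀ {o t a b c} → InRange o t a → InRange o t b → c ∈⟦ a , b ⟧ → InRange o t c
inRange-between (oa , _) (_ , bm) (inj₁ (ac , cb)) = <-≤-trans oa ac , ≤-trans cb bm
inRange-between (_ , am) (ob , _) (inj₂ (bc , ca)) = <-≤-trans ob bc , ≤-trans ca am

Desc-convex : ∀ {o t a b c} → Desc o t b a → c ∈⟦ a , b ⟧ → Desc o t c a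
Desc-convex {o} (here {l = l} {r} lo hi) c∈ =
  root-Desc (inRange-between (inRange-root o l r) (lo , hi) c∈)
Desc-convex (left d) c∈ = left (Desc-convex d c∈)
Desc-convex (right d) c∈ = right (Desc-convex d c∈)

Desc-root : ∀ {o l r v} → Desc o (node l r) (rootLabel o l) v → v ≡ rootLabel o l
Desc-root (here _ _) = refl
Desc-root (left d) = contradiction (<rootLabel (desc-inRange d)) (<-irrefl refl)
Desc-root (right d) = contradiction (InRange.lower (desc-inRange d)) (<-irrefl refl)

Desc-left⁻ : ∀ {o l r u v} → Desc o (node l r) u v →
  u < rootLabel o l → v < rootLabel o l → Desc o l u v
Desc-left⁻ (here _ _) _ v< = contradiction v< (<-irrefl refl)
Desc-left⁻ (left d) _ _ = d
Desc-left⁻ (right d) u< _ = contradiction (InRange.lower (desc-inRange d)) (<-asym u<)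

Desc-right⁻ : ∀ {o l r u v} → Desc o (node l r) u v →
  rootLabel o l < u → rootLabel o l < v → Desc (rootLabel o l) r u v
Desc-right⁻ (here _ _) _ <v = contradiction <v (<-irrefl refl)
Desc-right⁻ (left d) <u _ = contradiction (<rootLabel (desc-inRange d)) (<-asym <u)
Desc-right⁻ (right d) _ _ = d

-- Right rotations and the forests

RightRot-size : ∀ {T T'} → RightRot T T' → size T ≡ size T'
RightRot-size (rot {A} {B} {C}) = cong suc (right-offset (size A) B C)
RightRot-size (inL {r = r} rr) = cong (λ m → suc (m + size r)) (RightRot-size rr)
RightRot-size (inR {l = l} rr) = cong (λ m → suc (size l + m)) (RightRot-size rr)

≤T-size : ∀ {T T'} → T ≤T T' → size T ≡ size T'
≤T-size ε = refl
≤T-size (rr ◅ rrs) = trans (RightRot-size rr) (≤T-size rrs)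

-- Labels outside a subtree only see its size, so they survive replacing it.
Desc-graftˡ : ∀ {o l l' r a b} → size l ≡ size l' →
  Desc o (node l r) a b → Desc o l a b ⊎ Desc o (node l' r) a b
Desc-graftˡ {o} {l} {l'} {r} {a} e (here lo hi) =
  inj₂ (subst (Desc o (node l' r) a) (cong (λ m → suc (o + m)) (sym e))
    (here lo (subst (λ m → a ≤ o + suc (m + size r)) e hi)))
Desc-graftˡ e (left d) = inj₁ d
Desc-graftˡ {o} {r = r} {a} {b} e (right d) =
  inj₂ (right (subst (λ m → Desc (suc (o + m)) r a b) e d))

Desc-graftʳ : ∀ {o l r r' a b} → size r ≡ size r' →
  Desc o (node l r) a b → Desc (rootLabel o l) r a b ⊎ Desc o (node l r') a b
Desc-graftʳ {o} {l} {a = a} e (here lo hi) = inj₂ (here lo (subst (λ m → a ≤ o + suc (size l + m)) e hi))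
Desc-graftʳ e (left d) = inj₂ (left d)
Desc-graftʳ e (right d) = inj₁ d

module _ {o : ℕ} {A B C : Tree} where
  private
    P Q : Tree
    P = node (node A B) C
    Q = node A (node B C)
    x y : ℕ
    x = rootLabel o A
    y = rootLabel o (node A B)

    y≡ : rootLabel x B ≡ y
    y≡ = rootLabel-shift o A B

    x<y : x < y
    x<y = subst (x <_) y≡ (s≤s (m≤m+n x (size B)))

    P≡Q : size P ≡ size Q
    P≡Q = RightRot-size (rot {A} {B} {C})

  -- Only relations below the old root y are lost, and only relations below the new root x are gained.
  rotate-Desc⁺ : ∀ {u v} → Desc o P u v → Desc o Q u v ⊎ v ≡ y
  rotate-Desc⁺ (here _ _) = inj₂ refl
  rotate-Desc⁺ (left d@(here _ _)) =
    inj₁ (root-Desc (inRange-resize P≡Q (inRange-left (desc-inRange d))))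
  rotate-Desc⁺ (left (left d)) = inj₁ (left d)
  rotate-Desc⁺ (left (right d)) = inj₁ (right (left d))
  rotate-Desc⁺ {u} {v} (right d) = inj₁ (right (right (subst (λ m → Desc m C u v) (sym y≡) d)))

  rotate-Desc⁻ : ∀ {u v} → Desc o Q u v → Desc o P u v ⊎ v ≡ x
  rotate-Desc⁻ (here _ _) = inj₂ refl
  rotate-Desc⁻ {u} (right d@(here _ _)) =
    inj₁ (subst (Desc o P u) (sym y≡)
      (root-Desc (inRange-resize (sym P≡Q) (inRange-right (desc-inRange d)))))
  rotate-Desc⁻ (left d) = inj₁ (left (left d))
  rotate-Desc⁻ (right (left d)) = inj₁ (left (right d))
  rotate-Desc⁻ {u} {v} (right (right d)) = inj₁ (right (subst (λ m → Desc m C u v) y≡ d))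

  rotate-final : ∀ {a b} → a < b → Desc o P b a → Desc o Q b a
  rotate-final a<b d with rotate-Desc⁺ d
  ... | inj₁ d′ = d′
  ... | inj₂ refl = right (subst (Desc x (node B C) _) y≡ (root-Desc
          (inRange-right⁻ (inRange-resize P≡Q (desc-inRange d)) (<-trans x<y a<b))))

  rotate-initial : ∀ {a c} → a < c → Desc o Q a c → Desc o P a c
  rotate-initial a<c d with rotate-Desc⁻ d
  ... | inj₁ d′ = d′
  ... | inj₂ refl = left (root-Desc (inRange-left (inRange-left⁻ (desc-inRange d) a<c)))

RightRot-final : ∀ {o T T' a b} → RightRot T T' → a < b → Desc o T b a → Desc o T' b a
RightRot-final rot a<b d = rotate-final a<b d
RightRot-final (inL rr) a<b d =
  [ (λ d′ → left (RightRot-final rr a<b d′)) , id ]′ (Desc-graftˡ (RightRot-size rr) d)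
RightRot-final (inR rr) a<b d =
  [ (λ d′ → right (RightRot-final rr a<b d′)) , id ]′ (Desc-graftʳ (RightRot-size rr) d)

RightRot-initial : ∀ {o T T' a c} → RightRot T T' → a < c → Desc o T' a c → Desc o T a c
RightRot-initial rot a<c d = rotate-initial a<c d
RightRot-initial (inL rr) a<c d =
  [ (λ d′ → left (RightRot-initial rr a<c d′)) , id ]′ (Desc-graftˡ (sym (RightRot-size rr)) d)
RightRot-initial (inR rr) a<c d =
  [ (λ d′ → right (RightRot-initial rr a<c d′)) , id ]′ (Desc-graftʳ (sym (RightRot-size rr)) d)

≤T-final : ∀ {o T T'} → T ≤T T' → Final o T ⇒ Final o T'
≤T-final ε f = f
≤T-final (rr ◅ rrs) (a<b , d) = ≤T-final rrs (a<b , RightRot-final rr a<b d)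

≤T-initial : ∀ {o T T'} → T ≤T T' → Initial o T' ⇒ Initial o T
≤T-initial ε f = f
≤T-initial (rr ◅ rrs) f = let a<c , d = ≤T-initial rrs f in a<c , RightRot-initial rr a<c d

-- The forests determine the Tamari order

root-no-final : ∀ {o l r a} → ¬ Final o (node l r) (rootLabel o l) a
root-no-final (a<s , d) = <⇒≢ a<s (Desc-root d)

root-no-initial : ∀ {o l r c} → ¬ Initial o (node l r) (rootLabel o l) c
root-no-initial (s<c , d) = <⇒≢ s<c (sym (Desc-root d))

record RaisedRoot (o s : ℕ) (T : Tree) : Set where
  field
    A B    : Tree
    raise  : T ≤T node A B
    root≡  : rootLabel o A ≡ s
    final⊆ : ∀ {b a} → Final o (node A B) b a → Final o T b a ⊎ a ≡ s

record LoweredRoot (o s : ℕ) (T : Tree) : Set where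
  field
    A B      : Tree
    lower    : node A B ≤T T
    root≡    : rootLabel o A ≡ s
    initial⊆ : ∀ {a c} → Initial o (node A B) a c → Initial o T a c ⊎ c ≡ s

raise-root : ∀ T o s → InRange o T s → (∀ {a} → ¬ Final o T s a) → RaisedRoot o s T
raise-root leaf o s s∈ _ = contradiction s∈ inRange-leaf
raise-root (node l r) o s s∈ s-top with <-cmp s (rootLabel o l)
... | tri≈ _ s≡ _ = record { A = l ; B = r ; raise = ε ; root≡ = sym s≡ ; final⊆ = inj₁ }
... | tri> _ _ root<s = contradiction (root<s , root-Desc s∈) s-top
... | tri< s<root _ _ = record
  { A = A ; B = node B r ; raise = gmap (λ t → node t r) inL raise ◅◅ rot ◅ ε
  ; root≡ = root≡ ; final⊆ = final⊆′ }
  where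
  open RaisedRoot (raise-root l o s (inRange-left⁻ s∈ s<root) (λ (a<s , d) → s-top (a<s , left d)))
  final⊆′ : ∀ {b a} → Final o (node A (node B r)) b a → Final o (node l r) b a ⊎ a ≡ s
  final⊆′ (a<b , d) with rotate-Desc⁻ d
  ... | inj₂ refl = inj₂ root≡
  ... | inj₁ d′ with Desc-graftˡ (sym (≤T-size raise)) d′
  ...   | inj₂ d″ = inj₁ (a<b , d″)
  ...   | inj₁ d″ = ⊎-map₁ (λ (a<b , d) → a<b , left d) (final⊆ (a<b , d″))

lower-root : ∀ T o s → InRange o T s → (∀ {c} → ¬ Initial o T s c) → LoweredRoot o s T
lower-root leaf o s s∈ _ = contradiction s∈ inRange-leaf
lower-root (node l r) o s s∈ s-bottom with <-cmp s (rootLabel o l)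
... | tri≈ _ s≡ _ = record { A = l ; B = r ; lower = ε ; root≡ = sym s≡ ; initial⊆ = inj₁ }
... | tri< s<root _ _ = contradiction (s<root , root-Desc s∈) s-bottom
... | tri> _ _ root<s = record
  { A = node l A ; B = B ; lower = rot ◅ gmap (node l) inR lower
  ; root≡ = trans (sym (rootLabel-shift o l A)) root≡ ; initial⊆ = initial⊆′ }
  where
  open LoweredRoot
    (lower-root r (rootLabel o l) s (inRange-right⁻ s∈ root<s) (λ (s<c , d) → s-bottom (s<c , right d)))
  initial⊆′ : ∀ {a c} → Initial o (node (node l A) B) a c → Initial o (node l r) a c ⊎ c ≡ s
  initial⊆′ (a<c , d) with rotate-Desc⁺ d
  ... | inj₂ refl = inj₂ (trans (sym (rootLabel-shift o l A)) root≡)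
  ... | inj₁ d′ with Desc-graftʳ (≤T-size lower) d′
  ...   | inj₂ d″ = inj₁ (a<c , d″)
  ...   | inj₁ d″ = ⊎-map₁ (λ (a<c , d) → a<c , right d) (initial⊆ (a<c , d″))

root-sizes : ∀ {o A B L R} → rootLabel o A ≡ rootLabel o L → size (node A B) ≡ size (node L R) →
  size A ≡ size L × size B ≡ size R
root-sizes {o} {B = B} {L} rootA≡rootL AB≡LR = A≡L , B≡R
  where
  A≡L = +-cancelˡ-≡ o _ _ (suc-injective rootA≡rootL)
  B≡R = +-cancelˡ-≡ (size L) _ _ (trans (cong (_+ size B) (sym A≡L)) (suc-injective AB≡LR))

final⊆⇒≤T : ∀ S o T → size T ≡ size S → Final o T ⇒ Final o S → T ≤T S
final⊆⇒≤T leaf o leaf _ _ = ε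
final⊆⇒≤T (node L R) o T T≡S T⊆S =
  raise ◅◅ gmap (λ t → node t B) inL (final⊆⇒≤T L o A A≡L A⊆L)
        ◅◅ gmap (node L) inR (final⊆⇒≤T R s B B≡R B⊆R)
  where
  s = rootLabel o L
  open RaisedRoot
    (raise-root T o s (inRange-resize (sym T≡S) (inRange-root o L R)) (λ f → root-no-final (T⊆S f)))
  sizes = root-sizes root≡ (trans (sym (≤T-size raise)) T≡S)
  A≡L = proj₁ sizes
  B≡R = proj₂ sizes
  A⊆L : Final o A ⇒ Final o L
  A⊆L {b} {a} (a<b , d) =
    [ (λ f → a<b , Desc-left⁻ (proj₂ (T⊆S f)) b<s a<s) , (λ a≡s → contradiction a≡s (<⇒≢ a<s)) ]′
      (final⊆ (a<b , left d))
    where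
    b<s = subst (b <_) root≡ (<rootLabel (desc-inRange d))
    a<s = <-trans a<b b<s
  B⊆R : Final s B ⇒ Final s R
  B⊆R {b} {a} (a<b , d) =
    [ (λ f → a<b , Desc-right⁻ (proj₂ (T⊆S f)) (<-trans s<a a<b) s<a)
    , (λ a≡s → contradiction (sym a≡s) (<⇒≢ s<a)) ]′
      (final⊆ (a<b , right (subst (λ m → Desc m B b a) (sym root≡) d)))
    where s<a = InRange.lower (anc-inRange d)

initial⊆⇒≥T : ∀ S o T → size T ≡ size S → Initial o T ⇒ Initial o S → S ≤T T
initial⊆⇒≥T leaf o leaf _ _ = ε
initial⊆⇒≥T (node L R) o T T≡S T⊆S =
  gmap (λ t → node t R) inL (initial⊆⇒≥T L o A A≡L A⊆L)
    ◅◅ gmap (node A) inR (initial⊆⇒≥T R s B B≡R B⊆R) ◅◅ lower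
  where
  s = rootLabel o L
  open LoweredRoot
    (lower-root T o s (inRange-resize (sym T≡S) (inRange-root o L R)) (λ f → root-no-initial (T⊆S f)))
  sizes = root-sizes root≡ (trans (≤T-size lower) T≡S)
  A≡L = proj₁ sizes
  B≡R = proj₂ sizes
  A⊆L : Initial o A ⇒ Initial o L
  A⊆L {a} {c} (a<c , d) =
    [ (λ f → a<c , Desc-left⁻ (proj₂ (T⊆S f)) a<s c<s) , (λ c≡s → contradiction c≡s (<⇒≢ c<s)) ]′
      (initial⊆ (a<c , left d))
    where
    c<s = subst (c <_) root≡ (<rootLabel (anc-inRange d))
    a<s = <-trans a<c c<s
  B⊆R : Initial s B ⇒ Initial s R
  B⊆R {a} {c} (a<c , d) =
    [ (λ f → a<c , Desc-right⁻ (proj₂ (T⊆S f)) s<a s<c) , (λ c≡s → contradiction (sym c≡s) (<⇒≢ s<c)) ]′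
      (initial⊆ (a<c , right (subst (λ m → Desc m B a c) (sym root≡) d)))
    where
    s<a = InRange.lower (desc-inRange d)
    s<c = <-trans s<a a<c

-- Binary search trees and insertion

inorder : BST → List ℕ
inorder lf = []
inorder (nd l x r) = inorder l ++ x ∷ inorder r

root∈inorder : ∀ l x r → x ∈ inorder (nd l x r)
root∈inorder l x r = ∈-++⁺ʳ (inorder l) (here refl)

∈-inorder⁻ : ∀ l x r {a} → a ∈ inorder (nd l x r) → a ∈ inorder l ⊎ a ≡ x ⊎ a ∈ inorder r
∈-inorder⁻ l x r m with ∈-++⁻ (inorder l) m
... | inj₁ m′ = inj₁ m′
... | inj₂ (here a≡x) = inj₂ (inj₁ a≡x)
... | inj₂ (there m′) = inj₂ (inj₂ m′)

data Inserted (k : ℕ) : BST → BST → Set where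
  into-lf    : Inserted k lf (nd lf k lf)
  into-left  : ∀ {l l' x r} → k ≤ x → Inserted k l l' → Inserted k (nd l x r) (nd l' x r)
  into-right : ∀ {l x r r'} → x < k → Inserted k r r' → Inserted k (nd l x r) (nd l x r')

insert-graph : ∀ k t → Inserted k t (insert k t)
insert-graph k lf = into-lf
insert-graph k (nd l x r) with k ≤? x
... | yes k≤x = into-left k≤x (insert-graph k l)
... | no k≰x = into-right (≰⇒> k≰x) (insert-graph k r)

inorder-Inserted : ∀ {k t t'} → Inserted k t t' → inorder t' ↭ k ∷ inorder t
inorder-Inserted into-lf = ↭-refl
inorder-Inserted (into-left {x = x} {r} _ g) = ++⁺ʳ (x ∷ inorder r) (inorder-Inserted g)
inorder-Inserted {k} (into-right {l} {x} {r} {r'} _ g) = begin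
  inorder l ++ x ∷ inorder r'    ↭⟨ ++⁺ˡ (inorder l) (↭-prep x (inorder-Inserted g)) ⟩
  inorder l ++ x ∷ k ∷ inorder r ↭⟨ ++⁺ˡ (inorder l) (↭-swap x k ↭-refl) ⟩
  inorder l ++ k ∷ x ∷ inorder r ↭⟨ shift k (inorder l) (x ∷ inorder r) ⟩
  k ∷ inorder l ++ x ∷ inorder r ∎
  where open PermutationReasoning

inorder-ABR : ∀ σ → inorder (ABR σ) ↭ σ
inorder-ABR [] = ↭-refl
inorder-ABR (k ∷ σ) = ↭-trans (inorder-Inserted (insert-graph k (ABR σ))) (↭-prep k (inorder-ABR σ))

∈-ABR⁻ : ∀ {σ a} → a ∈ inorder (ABR σ) → a ∈ σ
∈-ABR⁻ {σ} = ∈-resp-↭ (inorder-ABR σ)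

∈-ABR⁺ : ∀ {σ a} → a ∈ σ → a ∈ inorder (ABR σ)
∈-ABR⁺ {σ} = ∈-resp-↭ (↭-sym (inorder-ABR σ))

∈-Inserted⁻ : ∀ {k t t' a} → Inserted k t t' → a ∈ inorder t' → a ≡ k ⊎ a ∈ inorder t
∈-Inserted⁻ g m with ∈-resp-↭ (inorder-Inserted g) m
... | here a≡k = inj₁ a≡k
... | there m′ = inj₂ m′

∈-Inserted⁺ : ∀ {k t t' a} → Inserted k t t' → a ≡ k ⊎ a ∈ inorder t → a ∈ inorder t'
∈-Inserted⁺ g (inj₁ a≡k) = ∈-resp-↭ (↭-sym (inorder-Inserted g)) (here a≡k)
∈-Inserted⁺ g (inj₂ m) = ∈-resp-↭ (↭-sym (inorder-Inserted g)) (there m)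

data LDesc : BST → ℕ → ℕ → Set where
  here  : ∀ {l x r a} → a ∈ inorder (nd l x r) → LDesc (nd l x r) a x
  left  : ∀ {l x r a b} → LDesc l a b → LDesc (nd l x r) a b
  right : ∀ {l x r a b} → LDesc r a b → LDesc (nd l x r) a b

LDesc-∈₁ : ∀ {t a b} → LDesc t a b → a ∈ inorder t
LDesc-∈₁ (here m) = m
LDesc-∈₁ (left d) = ∈-++⁺ˡ (LDesc-∈₁ d)
LDesc-∈₁ {nd l _ _} (right d) = ∈-++⁺ʳ (inorder l) (there (LDesc-∈₁ d))

LDesc-∈₂ : ∀ {t a b} → LDesc t a b → b ∈ inorder t
LDesc-∈₂ {nd l x r} (here _) = root∈inorder l x r
LDesc-∈₂ (left d) = ∈-++⁺ˡ (LDesc-∈₂ d)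
LDesc-∈₂ {nd l _ _} (right d) = ∈-++⁺ʳ (inorder l) (there (LDesc-∈₂ d))

LDesc-Inserted⁺ : ∀ {k t t' a b} → Inserted k t t' → LDesc t a b → LDesc t' a b
LDesc-Inserted⁺ g@(into-left _ _) (here m) = here (∈-Inserted⁺ g (inj₂ m))
LDesc-Inserted⁺ g@(into-right _ _) (here m) = here (∈-Inserted⁺ g (inj₂ m))
LDesc-Inserted⁺ (into-left _ g) (left d) = left (LDesc-Inserted⁺ g d)
LDesc-Inserted⁺ (into-right _ _) (left d) = left d
LDesc-Inserted⁺ (into-left _ _) (right d) = right d
LDesc-Inserted⁺ (into-right _ g) (right d) = right (LDesc-Inserted⁺ g d)

LDesc-Inserted⁻ : ∀ {k t t' a b} → Inserted k t t' → LDesc t' a b → LDesc t a b ⊎ a ≡ k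
LDesc-Inserted⁻ into-lf (here (here a≡k)) = inj₂ a≡k
LDesc-Inserted⁻ g@(into-left _ _) (here m) = ⊎-swap (⊎-map₂ here (∈-Inserted⁻ g m))
LDesc-Inserted⁻ g@(into-right _ _) (here m) = ⊎-swap (⊎-map₂ here (∈-Inserted⁻ g m))
LDesc-Inserted⁻ (into-left _ g) (left d) = ⊎-map₁ left (LDesc-Inserted⁻ g d)
LDesc-Inserted⁻ (into-right _ _) (left d) = inj₁ (left d)
LDesc-Inserted⁻ (into-left _ _) (right d) = inj₁ (right d)
LDesc-Inserted⁻ (into-right _ g) (right d) = ⊎-map₁ right (LDesc-Inserted⁻ g d)

Before-head : ∀ {σ u v} → v ∈ σ → Before (u ∷ σ) u v
Before-head {u = u} v∈σ = let ys , zs , σ≡ = ∈-∃++ v∈σ in [] , ys , zs , cong (u ∷_) σ≡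

Before-∷ : ∀ {σ u v w} → Before σ u v → Before (w ∷ σ) u v
Before-∷ {w = w} (xs , ys , zs , σ≡) = w ∷ xs , ys , zs , cong (w ∷_) σ≡

Before-tail : ∀ {σ u v w} → Before (w ∷ σ) u v → u ≢ w → Before σ u v
Before-tail ([] , _ , _ , σ≡) u≢w = contradiction (sym (∷-injectiveˡ σ≡)) u≢w
Before-tail (_ ∷ xs , ys , zs , σ≡) _ = xs , ys , zs , ∷-injectiveʳ σ≡

Before-∈₂ : ∀ {σ u v} → Before σ u v → v ∈ σ
Before-∈₂ (xs , ys , _ , refl) = ∈-++⁺ʳ xs (there (∈-++⁺ʳ ys (here refl)))

Before-unique-tail : ∀ {σ u v w} → Unique (w ∷ σ) → u ∈ σ → Before (w ∷ σ) u v → Before σ u v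
Before-unique-tail uniq u∈σ b = Before-tail b (λ { refl → Unique[x∷xs]⇒x∉xs uniq u∈σ })

ABR-LDesc⇒Before : ∀ σ {a b} → LDesc (ABR σ) a b → a ≢ b → Before σ a b
ABR-LDesc⇒Before (k ∷ σ) d a≢b with LDesc-Inserted⁻ (insert-graph k (ABR σ)) d
... | inj₁ d′ = Before-∷ (ABR-LDesc⇒Before σ d′ a≢b)
... | inj₂ refl = Before-head ([ (λ { refl → contradiction refl a≢b }) , ∈-ABR⁻ ]′
        (∈-Inserted⁻ (insert-graph k (ABR σ)) (LDesc-∈₂ d)))

data IsBST : BST → Set where
  lf : IsBST lf
  nd : ∀ {l x r} → IsBST l → IsBST r →
       All (_< x) (inorder l) → All (x <_) (inorder r) → IsBST (nd l x r)

Inserted-IsBST : ∀ {k t t'} → Inserted k t t' → IsBST t → k ∉ inorder t → IsBST t'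
Inserted-IsBST into-lf _ _ = nd lf lf [] []
Inserted-IsBST (into-left {l} {x = x} {r} k≤x g) (nd bl br l<x x<r) k∉ =
  nd (Inserted-IsBST g bl (k∉ ∘ ∈-++⁺ˡ)) br
    (All-resp-↭ (↭-sym (inorder-Inserted g)) (k<x ∷ l<x)) x<r
  where k<x = ≤∧≢⇒< k≤x (λ { refl → k∉ (root∈inorder l x r) })
Inserted-IsBST (into-right {l} x<k g) (nd bl br l<x x<r) k∉ =
  nd bl (Inserted-IsBST g br (k∉ ∘ ∈-++⁺ʳ (inorder l) ∘ there)) l<x
    (All-resp-↭ (↭-sym (inorder-Inserted g)) (x<k ∷ x<r))

ABR-IsBST : ∀ {σ} → Unique σ → IsBST (ABR σ)
ABR-IsBST {[]} _ = lf
ABR-IsBST {k ∷ σ} uniq@(_ ∷ uσ) =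
  Inserted-IsBST (insert-graph k (ABR σ)) (ABR-IsBST uσ) (Unique[x∷xs]⇒x∉xs uniq ∘ ∈-ABR⁻)

IsBST⇒sorted : ∀ {t} → IsBST t → AllPairs _<_ (inorder t)
IsBST⇒sorted lf = []
IsBST⇒sorted (nd bl br l<x x<r) =
  ++⁺ (IsBST⇒sorted bl) (x<r ∷ IsBST⇒sorted br) (All.map (λ y<x → y<x ∷ All.map (<-trans y<x) x<r) l<x)

LDesc-root : ∀ {l x r a} → IsBST (nd l x r) → LDesc (nd l x r) x a → a ≡ x
LDesc-root _ (here _) = refl
LDesc-root (nd _ _ l<x _) (left d) = contradiction (All.lookup l<x (LDesc-∈₁ d)) (<-irrefl refl)
LDesc-root (nd _ _ _ x<r) (right d) = contradiction (All.lookup x<r (LDesc-∈₁ d)) (<-irrefl refl)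

LDesc-left⁻ : ∀ {l x r a c} → IsBST (nd l x r) → a ∈ inorder l → LDesc (nd l x r) c a → LDesc l c a
LDesc-left⁻ (nd _ _ l<x _) a∈l (here _) = contradiction (All.lookup l<x a∈l) (<-irrefl refl)
LDesc-left⁻ _ _ (left d) = d
LDesc-left⁻ (nd _ _ l<x x<r) a∈l (right d) =
  contradiction (All.lookup l<x a∈l) (<-asym (All.lookup x<r (LDesc-∈₂ d)))

LDesc-right⁻ : ∀ {l x r a c} → IsBST (nd l x r) → a ∈ inorder r → LDesc (nd l x r) c a → LDesc r c a
LDesc-right⁻ (nd _ _ _ x<r) a∈r (here _) = contradiction (All.lookup x<r a∈r) (<-irrefl refl)
LDesc-right⁻ (nd _ _ l<x x<r) a∈r (left d) =
  contradiction (All.lookup x<r a∈r) (<-asym (All.lookup l<x (LDesc-∈₂ d)))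
LDesc-right⁻ _ _ (right d) = d

Inserted-below : ∀ {k t t' a} → Inserted k t t' → IsBST t → a ∈ inorder t → a ≢ k →
  (∀ c → c ∈ inorder t → c ∈⟦ a , k ⟧ → c ≢ a → LDesc t c a) → LDesc t' k a
Inserted-below {t = nd l x r} g@(into-left k≤x g′) bst@(nd bl _ _ x<r) a∈t a≢k between
  with ∈-inorder⁻ l x r a∈t
... | inj₁ a∈l = left (Inserted-below g′ bl a∈l a≢k
        (λ c c∈l c∈⟦⟧ c≢a → LDesc-left⁻ bst a∈l (between c (∈-++⁺ˡ c∈l) c∈⟦⟧ c≢a)))
... | inj₂ (inj₁ refl) = here (∈-Inserted⁺ g (inj₁ refl))
... | inj₂ (inj₂ a∈r) = contradiction
        (LDesc-root bst (between x (root∈inorder l x r) (inj₂ (k≤x , <⇒≤ x<a)) (<⇒≢ x<a)))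
        (≢-sym (<⇒≢ x<a))
  where x<a = All.lookup x<r a∈r
Inserted-below {t = nd l x r} g@(into-right x<k g′) bst@(nd _ br l<x _) a∈t a≢k between
  with ∈-inorder⁻ l x r a∈t
... | inj₁ a∈l = contradiction
        (LDesc-root bst (between x (root∈inorder l x r) (inj₁ (<⇒≤ a<x , <⇒≤ x<k)) (≢-sym (<⇒≢ a<x))))
        (<⇒≢ a<x)
  where a<x = All.lookup l<x a∈l
... | inj₂ (inj₁ refl) = here (∈-Inserted⁺ g (inj₁ refl))
... | inj₂ (inj₂ a∈r) = right (Inserted-below g′ br a∈r a≢k
        (λ c c∈r c∈⟦⟧ c≢a → LDesc-right⁻ bst a∈r (between c (∈-++⁺ʳ (inorder l) (there c∈r)) c∈⟦⟧ c≢a)))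

ABR-LDesc : ∀ σ {a b} → Unique σ → a ∈ σ → b ∈ σ → a ≢ b →
  (∀ c → c ∈ σ → c ∈⟦ a , b ⟧ → c ≢ a → Before σ c a) → LDesc (ABR σ) b a
ABR-LDesc (k ∷ σ) uniq (here refl) (here refl) a≢b _ = contradiction refl a≢b
ABR-LDesc (k ∷ σ) {b = b} uniq (here refl) (there b∈σ) a≢b before =
  contradiction
    (Before-∈₂ (Before-unique-tail uniq b∈σ (before b (there b∈σ) (∈⟦⟧-endpoint k b) (≢-sym a≢b))))
    (Unique[x∷xs]⇒x∉xs uniq)
ABR-LDesc (k ∷ σ) {a} uniq@(_ ∷ uσ) (there a∈σ) (here refl) a≢b before =
  Inserted-below (insert-graph k (ABR σ)) (ABR-IsBST uσ) (∈-ABR⁺ a∈σ) a≢b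
    (λ c c∈ c∈⟦⟧ c≢a → ABR-LDesc σ uσ a∈σ (∈-ABR⁻ c∈) (≢-sym c≢a)
      (λ d d∈σ d∈⟦⟧ d≢a → Before-unique-tail uniq d∈σ (before d (there d∈σ) (∈⟦⟧-trans d∈⟦⟧ c∈⟦⟧) d≢a)))
ABR-LDesc (k ∷ σ) uniq@(_ ∷ uσ) (there a∈σ) (there b∈σ) a≢b before =
  LDesc-Inserted⁺ (insert-graph k (ABR σ)) (ABR-LDesc σ uσ a∈σ b∈σ a≢b
    (λ c c∈σ c∈⟦⟧ c≢a → Before-unique-tail uniq c∈σ (before c (there c∈σ) c∈⟦⟧ c≢a)))

-- Sylvester classes

label : ℕ → Tree → BST
label o leaf = lf
label o (node l r) = nd (label o l) (rootLabel o l) (label (rootLabel o l) r)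

shape-label : ∀ o T → shape (label o T) ≡ T
shape-label o leaf = refl
shape-label o (node l r) = cong₂ node (shape-label o l) (shape-label (rootLabel o l) r)

∈-label⁺ : ∀ {o T a} → InRange o T a → a ∈ inorder (label o T)
∈-label⁺ {T = leaf} a∈ = contradiction a∈ inRange-leaf
∈-label⁺ {o} {node l r} {a} a∈ with <-cmp a (rootLabel o l)
... | tri< a<root _ _ = ∈-++⁺ˡ (∈-label⁺ (inRange-left⁻ a∈ a<root))
... | tri≈ _ refl _ = root∈inorder (label o l) a (label a r)
... | tri> _ _ root<a = ∈-++⁺ʳ (inorder (label o l)) (there (∈-label⁺ (inRange-right⁻ a∈ root<a)))

∈-label⁻ : ∀ o T {a} → a ∈ inorder (label o T) → InRange o T a
∈-label⁻ o (node l r) m with ∈-inorder⁻ (label o l) (rootLabel o l) (label (rootLabel o l) r) m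
... | inj₁ m′ = inRange-left (∈-label⁻ o l m′)
... | inj₂ (inj₁ refl) = inRange-root o l r
... | inj₂ (inj₂ m′) = inRange-right (∈-label⁻ (rootLabel o l) r m′)

label-IsBST : ∀ o T → IsBST (label o T)
label-IsBST o leaf = lf
label-IsBST o (node l r) = nd (label-IsBST o l) (label-IsBST (rootLabel o l) r)
  (All.tabulate (<rootLabel ∘ ∈-label⁻ o l)) (All.tabulate (InRange.lower ∘ ∈-label⁻ (rootLabel o l) r))

Desc⇒LDesc : ∀ {o T a b} → Desc o T a b → LDesc (label o T) a b
Desc⇒LDesc (here lo hi) = here (∈-label⁺ (lo , hi))
Desc⇒LDesc (left d) = left (Desc⇒LDesc d)
Desc⇒LDesc (right d) = right (Desc⇒LDesc d)

LDesc⇒Desc : ∀ {o T a b} → LDesc (label o T) a b → Desc o T a b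
LDesc⇒Desc {o} {node l r} (here m) = root-Desc (∈-label⁻ o (node l r) m)
LDesc⇒Desc {T = node l r} (left d) = left (LDesc⇒Desc d)
LDesc⇒Desc {T = node l r} (right d) = right (LDesc⇒Desc d)

strictlySorted-≡ : ∀ {xs ys} → AllPairs _<_ xs → AllPairs _<_ ys → xs ∼[ set ] ys → xs ≡ ys
strictlySorted-≡ xs< ys< xs≈ys = Pointwise-≡⇒≡
  (↗↭↗⇒≋ ≤-totalOrder (sorted xs<) (sorted ys<)
    (↭⇒↭ₛ (∼bag⇒↭ (unique∧set⇒bag (unique xs<) (unique ys<) xs≈ys))))
  where
  sorted : ∀ {zs} → AllPairs _<_ zs → Sorted ≤-totalOrder zs
  sorted = AllPairs⇒Sorted ≤-totalOrder ∘ AllPairs.map <⇒≤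
  unique : ∀ {zs} → AllPairs _<_ zs → Unique zs
  unique = AllPairs.map <⇒≢

length-inorder : ∀ t → length (inorder t) ≡ size (shape t)
length-inorder lf = refl
length-inorder (nd l x r) = begin
  length (inorder l ++ x ∷ inorder r)
    ≡⟨ length-++ (inorder l) ⟩
  length (inorder l) + suc (length (inorder r))
    ≡⟨ cong₂ (λ m n → m + suc n) (length-inorder l) (length-inorder r) ⟩
  size (shape l) + suc (size (shape r))
    ≡⟨ +-suc (size (shape l)) _ ⟩
  size (shape (nd l x r)) ∎
  where open ≡-Reasoning

++-cancel-length : ∀ (xs ys : List ℕ) {zs ws} → length xs ≡ length ys →
  xs ++ zs ≡ ys ++ ws → xs ≡ ys × zs ≡ ws
++-cancel-length [] [] _ e = refl , e
++-cancel-length (x ∷ xs) (y ∷ ys) |xs|≡|ys| e =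
  let x≡y , e′ = ∷-injective e
      xs≡ys , zs≡ws = ++-cancel-length xs ys (suc-injective |xs|≡|ys|) e′
  in cong₂ _∷_ x≡y xs≡ys , zs≡ws

node-injective : ∀ {l r l' r'} → node l r ≡ node l' r' → l ≡ l' × r ≡ r'
node-injective refl = refl , refl

inorder-injective : ∀ t t' → shape t ≡ shape t' → inorder t ≡ inorder t' → t ≡ t'
inorder-injective lf lf _ _ = refl
inorder-injective (nd l x r) (nd l' x' r') shape≡ inorder≡ =
  nd-cong (inorder-injective l l' l≡ inorderl≡) (∷-injectiveˡ rest≡)
    (inorder-injective r r' r≡ (∷-injectiveʳ rest≡))
  where
  nd-cong : ∀ {l l' x x' r r'} → l ≡ l' → x ≡ x' → r ≡ r' → nd l x r ≡ nd l' x' r'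
  nd-cong refl refl refl = refl
  l≡ = proj₁ (node-injective shape≡)
  r≡ = proj₂ (node-injective shape≡)
  split = ++-cancel-length (inorder l) (inorder l')
    (trans (length-inorder l) (trans (cong size l≡) (sym (length-inorder l')))) inorder≡
  inorderl≡ = proj₁ split
  rest≡ = proj₂ split

IsPerm-Unique : ∀ {n σ} → IsPerm n σ → Unique σ
IsPerm-Unique {n} perm = Unique-resp-↭ (↭⇒↭ₛ (↭-sym perm)) (Unique-map⁺ suc-injective (upTo⁺ n))

∈-IsPerm⁻ : ∀ {T σ a} → IsPerm (size T) σ → a ∈ σ → InRange 0 T a
∈-IsPerm⁻ perm a∈σ with i , i∈ , refl ← ∈-map⁻ suc (∈-resp-↭ perm a∈σ) = s≤s z≤n , ∈-upTo⁻ i∈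

∈-IsPerm⁺ : ∀ {T σ a} → IsPerm (size T) σ → InRange 0 T a → a ∈ σ
∈-IsPerm⁺ perm (s≤s _ , a≤n) = ∈-resp-↭ (↭-sym perm) (∈-map⁺ suc (∈-upTo⁺ a≤n))

ABR-size : ∀ {n σ} → IsPerm n σ → size (shape (ABR σ)) ≡ n
ABR-size {n} {σ} perm = begin
  size (shape (ABR σ))     ≡⟨ length-inorder (ABR σ) ⟨
  length (inorder (ABR σ)) ≡⟨ ↭-length (↭-trans (inorder-ABR σ) perm) ⟩
  length (map suc (upTo n)) ≡⟨ length-map suc (upTo n) ⟩
  length (upTo n)          ≡⟨ length-upTo n ⟩
  n                        ∎
  where open ≡-Reasoning

ABR-sylvester : ∀ {n σ} → IsPerm n σ → InSylv (shape (ABR σ)) σ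
ABR-sylvester {σ = σ} perm = subst (λ m → IsPerm m σ) (sym (ABR-size perm)) perm , refl

-- ABR σ is the canonical labelling of its shape, since both are binary search trees on the labels 1,…,n.
sylvester-canonical : ∀ {S σ} → InSylv S σ → ABR σ ≡ label 0 S
sylvester-canonical {σ = σ} (perm , refl) =
  inorder-injective (ABR σ) (label 0 S) (sym (shape-label 0 S))
    (strictlySorted-≡ (IsBST⇒sorted (ABR-IsBST (IsPerm-Unique perm))) (IsBST⇒sorted (label-IsBST 0 S)) same-labels)
  where
  S = shape (ABR σ)
  same-labels : inorder (ABR σ) ∼[ set ] inorder (label 0 S)
  same-labels = mk⇔ (∈-label⁺ ∘ ∈-IsPerm⁻ perm ∘ ∈-ABR⁻) (∈-ABR⁺ ∘ ∈-IsPerm⁺ perm ∘ ∈-label⁻ 0 S)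

sylvester-Desc⇒Before : ∀ {S σ a b} → InSylv S σ → Desc 0 S a b → a ≢ b → Before σ a b
sylvester-Desc⇒Before {σ = σ} sylv d =
  ABR-LDesc⇒Before σ (subst (λ t → LDesc t _ _) (sym (sylvester-canonical sylv)) (Desc⇒LDesc d))

sylvester-Before⇒Desc : ∀ {S σ a b} → InSylv S σ → InRange 0 S a → InRange 0 S b → a ≢ b →
  (∀ c → c ∈⟦ a , b ⟧ → c ≢ a → Before σ c a) → Desc 0 S b a
sylvester-Before⇒Desc {σ = σ} sylv@(perm , _) a∈ b∈ a≢b before =
  LDesc⇒Desc (subst (λ t → LDesc t _ _) (sylvester-canonical sylv)
    (ABR-LDesc σ (IsPerm-Unique perm) (∈-IsPerm⁺ perm a∈) (∈-IsPerm⁺ perm b∈) a≢b (λ c _ → before c)))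

-- By convexity, a linear extension of F≥(T) places the whole label interval between a and b before a.
linExt-final⊆ : ∀ {T S σ} → InSylv S σ → size T ≡ size S →
  (∀ u v → FinalForest T u v → Before σ u v) → FinalForest T ⇒ FinalForest S
linExt-final⊆ sylv T≡S before (a<b , d) = a<b , sylvester-Before⇒Desc sylv
  (inRange-resize T≡S (anc-inRange d)) (inRange-resize T≡S (desc-inRange d)) (<⇒≢ a<b)
  (λ c c∈ c≢a → before c _ (∈⟦⟧-above a<b c∈ c≢a , Desc-convex d c∈))

linExt-initial⊆ : ∀ {T S σ} → InSylv S σ → size T ≡ size S →
  (∀ u v → InitialForest T u v → Before σ u v) → InitialForest T ⇒ InitialForest S
linExt-initial⊆ sylv T≡S before (a<c , d) = a<c , sylvester-Before⇒Desc sylv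
  (inRange-resize T≡S (anc-inRange d)) (inRange-resize T≡S (desc-inRange d)) (≢-sym (<⇒≢ a<c))
  (λ x x∈ x≢c → before x _ (∈⟦⟧-below a<c x∈ x≢c , Desc-convex d x∈))

proposition7p1p3 : (T : Tree) → (σ : List ℕ) →
    (LinExt (size T) (FinalForest T) σ ⇔ ∃ (λ T' → T ≤T T' × InSylv T' σ))
    × (LinExt (size T) (InitialForest T) σ ⇔ ∃ (λ T' → T' ≤T T × InSylv T' σ))
proposition7p1p3 T σ = mk⇔ final⇒ final⇐ , mk⇔ initial⇒ initial⇐
  where
  S = shape (ABR σ)
  permOf : ∀ {T'} → size T' ≡ size T → InSylv T' σ → IsPerm (size T) σ
  permOf T'≡T (perm , _) = subst (λ m → IsPerm m σ) T'≡T perm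
  final⇒ : LinExt (size T) (FinalForest T) σ → ∃ (λ T' → T ≤T T' × InSylv T' σ)
  final⇒ (perm , before) = S , final⊆⇒≤T S 0 T T≡S (linExt-final⊆ sylv T≡S before) , sylv
    where sylv = ABR-sylvester perm ; T≡S = sym (ABR-size perm)

  final⇐ : ∃ (λ T' → T ≤T T' × InSylv T' σ) → LinExt (size T) (FinalForest T) σ
  final⇐ (T' , T≤T' , sylv) = permOf (sym (≤T-size T≤T')) sylv ,
    λ u v f → sylvester-Desc⇒Before sylv (proj₂ (≤T-final T≤T' f)) (≢-sym (<⇒≢ (proj₁ f)))

  initial⇒ : LinExt (size T) (InitialForest T) σ → ∃ (λ T' → T' ≤T T × InSylv T' σ)
  initial⇒ (perm , before) = S , initial⊆⇒≥T S 0 T T≡S (linExt-initial⊆ sylv T≡S before) , sylv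
    where sylv = ABR-sylvester perm ; T≡S = sym (ABR-size perm)

  initial⇐ : ∃ (λ T' → T' ≤T T × InSylv T' σ) → LinExt (size T) (InitialForest T) σ
  initial⇐ (T' , T'≤T , sylv) = permOf (≤T-size T'≤T) sylv ,
    λ u v f → sylvester-Desc⇒Before sylv (proj₂ (≤T-initial T'≤T f)) (<⇒≢ (proj₁ f))
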